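{- In every $\omega$-catoid $(C,\odot_i,s_i,t_i)_{0\le i<\omega}$, for all $0\le i<j<\omega$ and all $x,y\in C$ with $x\odot_j y\neq\emptyset$: $s_i(x\odot_j y)=\{s_i(x)\}=\{s_i(y)\}$ and $t_i(x\odot_j y)=\{t_i(x)\}=\{t_i(y)\}$.
   Context: A catoid $(C,\odot,s,t)$ is a set with $\odot:C\times C\to\mathcal P C$ and $s,t:C\to C$ such that, with $X\odot Y=\bigcup_{x\in X,y\in Y}x\odot y$: $x\odot(y\odot z)=(x\odot y)\odot z$, $x\odot y\ne\emptyset\Rightarrow t(x)=s(y)$, $s(x)\odot x=\{x\}$, $x\odot t(x)=\{x\}$. Direct images under $s,t$ are written $s(X),t(X)$. An $\omega$-catoid is a family of catoids $(C,\odot_i,s_i,t_i)_{0\le i<\omega}$ on one set with, for $i\ne j$: $s_is_j=s_js_i$, $s_it_j=t_js_i$, $t_it_j=t_jt_i$, $s_i(x\odot_j y)\subseteq s_i(x)\odot_j s_i(y)$, $t_i(x\odot_j y)\subseteq t_i(x)\odot_j t_i(y)$; for $i<j$: $(w\odot_jx)\odot_i(y\odot_jz)\subseteq(w\odot_iy)\odot_j(x\odot_iz)$, $s_js_i=s_i$, $s_jt_i=t_i$, $t_js_i=s_i$, $t_jt_i=t_i$. -}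

module Defs where

open import Level using (Level; _⊔_) renaming (suc to lsuc)
open import Data.Nat using (ℕ; _<_)
open import Data.Product using (Σ; ∃; _×_; _,_)
open import Relation.Nullary using (¬_)
open import Relation.Binary.PropositionalEquality using (_≡_)
open import Relation.Unary using (Pred; _∈_; _⊆_; _≐_; ｛_｝; Satisfiable)

-- Powerset 𝒫 C is rendered as predicates Pred C ℓ; set equality is
-- extensional equality _≐_ (mutual inclusion).

lift : ∀ {c ℓ ℓ₁ ℓ₂} {C : Set c} →
       (C → C → Pred C ℓ) → Pred C ℓ₁ → Pred C ℓ₂ → Pred C (c ⊔ ℓ ⊔ ℓ₁ ⊔ ℓ₂)
lift {C = C} _⊙_ X Y z = Σ C λ x → Σ C λ y → (x ∈ X) × (y ∈ Y) × (z ∈ (x ⊙ y))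

image : ∀ {c ℓ₁} {C : Set c} → (C → C) → Pred C ℓ₁ → Pred C (c ⊔ ℓ₁)
image {C = C} f X z = Σ C λ x → (x ∈ X) × (z ≡ f x)

module _ {c ℓ : Level} {C : Set c} where

  record IsCatoid (_⊙_ : C → C → Pred C ℓ) (s t : C → C) : Set (c ⊔ lsuc ℓ) where
    field
      assoc   : ∀ x y z → lift _⊙_ ｛ x ｝ (y ⊙ z) ≐ lift _⊙_ (x ⊙ y) ｛ z ｝
      local   : ∀ x y → Satisfiable (x ⊙ y) → t x ≡ s y
      s-unit  : ∀ x → (s x ⊙ x) ≐ ｛ x ｝
      t-unit  : ∀ x → (x ⊙ t x) ≐ ｛ x ｝

record OmegaCatoid (c ℓ : Level) : Set (lsuc (c ⊔ ℓ)) where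
  field
    Carrier : Set c
    mul     : ℕ → Carrier → Carrier → Pred Carrier ℓ
    src tgt : ℕ → Carrier → Carrier
    isCatoid : ∀ i → IsCatoid (mul i) (src i) (tgt i)
    ss-comm : ∀ i j → ¬ i ≡ j → ∀ x → src i (src j x) ≡ src j (src i x)
    st-comm : ∀ i j → ¬ i ≡ j → ∀ x → src i (tgt j x) ≡ tgt j (src i x)
    tt-comm : ∀ i j → ¬ i ≡ j → ∀ x → tgt i (tgt j x) ≡ tgt j (tgt i x)
    src-hom : ∀ i j → ¬ i ≡ j → ∀ x y →
              image (src i) (mul j x y) ⊆ mul j (src i x) (src i y)
    tgt-hom : ∀ i j → ¬ i ≡ j → ∀ x y →
              image (tgt i) (mul j x y) ⊆ mul j (tgt i x) (tgt i y)
    interchange : ∀ i j → i < j → ∀ w x y z →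
                  lift (mul i) (mul j w x) (mul j y z)
                    ⊆ lift (mul j) (mul i w y) (mul i x z)
    sj-si : ∀ i j → i < j → ∀ x → src j (src i x) ≡ src i x
    sj-ti : ∀ i j → i < j → ∀ x → src j (tgt i x) ≡ tgt i x
    tj-si : ∀ i j → i < j → ∀ x → tgt j (src i x) ≡ src i x
    tj-ti : ∀ i j → i < j → ∀ x → tgt j (tgt i x) ≡ tgt i x

{-# OPTIONS --safe #-}
module Submission where

open import Defs
open import Level using (Level)
open import Data.Nat using (ℕ; _<_)
open import Data.Nat.Properties using (<⇒≢; >⇒≢)
open import Data.Product using (_×_; _,_; proj₁)
open import Function using (id)
open import Relation.Unary using (Pred; _∈_; _⊆_; _≐_; ｛_｝; Satisfiable)
open import Relation.Binary.PropositionalEquality using (_≡_; refl; sym; trans; cong; subst)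

-- Locality tⱼ x = sⱼ y, pushed through sᵢ and tᵢ (which absorb sⱼ, tⱼ for i < j),
-- makes the i-faces of x and y agree.  An i-face, viewed in dimension j, is a
-- j-identity, so by the homomorphism laws the i-faces of every composite
-- x ⊙ⱼ y lie in the square of an identity, which is a singleton.

≐-｛｝ : ∀ {a} {A : Set a} {x y : A} → x ≡ y → ｛ x ｝ ≐ ｛ y ｝
≐-｛｝ refl = id , id

image-const : ∀ {c ℓ} {C : Set c} {f : C → C} {X : Pred C ℓ} {a : C} →
              Satisfiable X → (∀ {w} → w ∈ X → a ≡ f w) → image f X ≐ ｛ a ｝
image-const {a = a} (z , z∈X) const =
  (λ { (w , w∈X , refl) → const w∈X }) , (λ { refl → z , z∈X , const z∈X })

module _ {c ℓ} {C : Set c} {_⊙_ : C → C → Pred C ℓ} {s t : C → C}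
         (catoid : IsCatoid _⊙_ s t) where

  open IsCatoid catoid

  identity-square⊆｛｝ : ∀ {a} → s a ≡ a → (a ⊙ a) ⊆ ｛ a ｝
  identity-square⊆｛｝ {a} sa≡a w∈a⊙a =
    proj₁ (s-unit a) (subst (λ b → _ ∈ (b ⊙ a)) (sym sa≡a) w∈a⊙a)

module _ {c ℓ} (Ω : OmegaCatoid c ℓ) {i j : ℕ} (i<j : i < j) where

  open OmegaCatoid Ω

  src-tgt-absorb : ∀ x → src i (tgt j x) ≡ src i x
  src-tgt-absorb x = trans (st-comm i j (<⇒≢ i<j) x) (tj-si i j i<j x)

  src-src-absorb : ∀ x → src i (src j x) ≡ src i x
  src-src-absorb x = trans (ss-comm i j (<⇒≢ i<j) x) (sj-si i j i<j x)

  tgt-tgt-absorb : ∀ x → tgt i (tgt j x) ≡ tgt i x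
  tgt-tgt-absorb x = trans (tt-comm i j (<⇒≢ i<j) x) (tj-ti i j i<j x)

  tgt-src-absorb : ∀ x → tgt i (src j x) ≡ tgt i x
  tgt-src-absorb x = trans (sym (st-comm j i (>⇒≢ i<j) x)) (sj-ti i j i<j x)

  src-local : ∀ {x y} → Satisfiable (mul j x y) → src i x ≡ src i y
  src-local {x} {y} xy≢∅ = trans (sym (src-tgt-absorb x))
    (trans (cong (src i) (IsCatoid.local (isCatoid j) x y xy≢∅)) (src-src-absorb y))

  tgt-local : ∀ {x y} → Satisfiable (mul j x y) → tgt i x ≡ tgt i y
  tgt-local {x} {y} xy≢∅ = trans (sym (tgt-tgt-absorb x))
    (trans (cong (tgt i) (IsCatoid.local (isCatoid j) x y xy≢∅)) (tgt-src-absorb y))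

  src-const : ∀ {x y w} → w ∈ mul j x y → src i x ≡ src i w
  src-const {x} {y} {w} w∈xy = identity-square⊆｛｝ (isCatoid j) (sj-si i j i<j x) sw∈sx⊙sx
    where
    sw∈sx⊙sx : src i w ∈ mul j (src i x) (src i x)
    sw∈sx⊙sx = subst (λ b → src i w ∈ mul j (src i x) b) (sym (src-local (w , w∈xy)))
                     (src-hom i j (<⇒≢ i<j) x y (w , w∈xy , refl))

  tgt-const : ∀ {x y w} → w ∈ mul j x y → tgt i x ≡ tgt i w
  tgt-const {x} {y} {w} w∈xy = identity-square⊆｛｝ (isCatoid j) (sj-ti i j i<j x) tw∈tx⊙tx
    where
    tw∈tx⊙tx : tgt i w ∈ mul j (tgt i x) (tgt i x)
    tw∈tx⊙tx = subst (λ b → tgt i w ∈ mul j (tgt i x) b) (sym (tgt-local (w , w∈xy)))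
                     (tgt-hom i j (<⇒≢ i<j) x y (w , w∈xy , refl))

lemma6p8 : ∀ {c ℓ : Level} (Ω : OmegaCatoid c ℓ) →
    let open OmegaCatoid Ω in
    ∀ (i j : ℕ) → i < j → ∀ (x y : Carrier) → Satisfiable (mul j x y) →
    ((image (src i) (mul j x y) ≐ ｛ src i x ｝) × (｛ src i x ｝ ≐ ｛ src i y ｝))
    × ((image (tgt i) (mul j x y) ≐ ｛ tgt i x ｝) × (｛ tgt i x ｝ ≐ ｛ tgt i y ｝))
lemma6p8 Ω i j i<j x y xy≢∅ =
    (image-const xy≢∅ (src-const Ω i<j) , ≐-｛｝ (src-local Ω i<j xy≢∅))
  , (image-const xy≢∅ (tgt-const Ω i<j) , ≐-｛｝ (tgt-local Ω i<j xy≢∅))
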